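{- For every sequent $\Gamma\Rightarrow\Delta$ (with $|\Delta|\le1$) of formulas of $\mathcal{L}^\Box$: $\Gamma\Rightarrow\Delta$ is derivable in $\mathsf{S.ConstCK}^{\Box}$ if and only if $\iota(\Gamma\Rightarrow\Delta)$ is derivable in $\mathsf{ConstCK}^{\Box}$.
   Context: Language $\mathcal{L}^\Box$: formulas $\varphi ::= p \mid \bot \mid \varphi\wedge\varphi \mid \varphi\vee\varphi \mid \varphi\to\varphi \mid \varphi \mathbin{\Box\!\!\rightarrow} \varphi$; $\wedge,\vee$ bind more strongly than $\to,\mathbin{\Box\!\!\rightarrow}$; $\top:=\bot\to\bot$, $\varphi\leftrightarrow\psi:=(\varphi\to\psi)\wedge(\psi\to\varphi)$. $\mathsf{ConstCK}^{\Box}$: intuitionistic propositional logic in $\mathcal{L}^\Box$ with modus ponens, plus CM$_\Box$: $(\varphi\mathbin{\Box\!\!\rightarrow}\psi\wedge\chi)\to(\varphi\mathbin{\Box\!\!\rightarrow}\psi)\wedge(\varphi\mathbin{\Box\!\!\rightarrow}\chi)$; CC$_\Box$: $(\varphi\mathbin{\Box\!\!\rightarrow}\psi)\wedge(\varphi\mathbin{\Box\!\!\rightarrow}\chi)\to(\varphi\mathbin{\Box\!\!\rightarrow}\psi\wedge\chi)$; CN$_\Box$: $\varphi\mathbin{\Box\!\!\rightarrow}\top$; RA$_\Box$: from $\varphi\leftrightarrow\rho$ infer $(\varphi\mathbin{\Box\!\!\rightarrow}\psi)\leftrightarrow(\rho\mathbin{\Box\!\!\rightarrow}\psi)$; RC$_\Box$: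 from $\psi\leftrightarrow\chi$ infer $(\varphi\mathbin{\Box\!\!\rightarrow}\psi)\leftrightarrow(\varphi\mathbin{\Box\!\!\rightarrow}\chi)$. Sequents $\Gamma\Rightarrow\Delta$: finite multisets, $|\Delta|\le1$; $\iota(\Gamma\Rightarrow\Delta)=\bigwedge\Gamma\to\bigvee\Delta$ if $\Gamma\neq\emptyset$, $\bigvee\Delta$ if $\Gamma=\emptyset$, with $\bigvee\emptyset=\bot$. $\varphi\Leftrightarrow\rho$ abbreviates the two sequents $\varphi\Rightarrow\rho$, $\rho\Rightarrow\varphi$. Rules of $\mathsf{S.ConstCK}^{\Box}$ ($|\Delta|\le1$, $n\ge0$): init: $\Gamma,p\Rightarrow p$; $\bot_L$: $\Gamma,\bot\Rightarrow\Delta$; $\wedge_L$: $\Gamma,\varphi,\psi\Rightarrow\Delta$ / $\Gamma,\varphi\wedge\psi\Rightarrow\Delta$; $\wedge_R$: $\Gamma\Rightarrow\varphi$, $\Gamma\Rightarrow\psi$ / $\Gamma\Rightarrow\varphi\wedge\psi$; $\vee_L$: $\Gamma,\varphi\Rightarrow\Delta$, $\Gamma,\psi\Rightarrow\Delta$ / $\Gamma,\varphi\vee\psi\Rightarrow\Delta$; $\vee_R^1$: $\Gamma\Rightarrow\varphi$ / $\Gamma\Rightarrow\varphi\vee\psi$; $\vee_R^2$: $\Gamma\Rightarrow\psi$ / $\Gamma\Rightarrow\varphi\vee\psi$; $\to_R$: $\Gamma,\varphi\Rightarrow\psi$ / $\Gamma\Rightarrow\varphi\to\psi$; $\to_L$: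 $\Gamma,\varphi\to\psi\Rightarrow\varphi$, $\Gamma,\psi\Rightarrow\Delta$ / $\Gamma,\varphi\to\psi\Rightarrow\Delta$; $\Box$: $\{\varphi\Leftrightarrow\rho_i\}_{i\le n}$, $\sigma_1,\dots,\sigma_n\Rightarrow\psi$ / $\Gamma,\rho_1\mathbin{\Box\!\!\rightarrow}\sigma_1,\dots,\rho_n\mathbin{\Box\!\!\rightarrow}\sigma_n\Rightarrow\varphi\mathbin{\Box\!\!\rightarrow}\psi$. -}

module Defs where

open import Data.Nat using (ℕ)
open import Data.List using (List; []; _∷_; map)
open import Data.List.Relation.Unary.All using (All)
open import Data.List.Relation.Binary.Permutation.Propositional using (_↭_)
open import Data.Maybe using (Maybe; just; nothing)
open import Data.Product using (_×_; _,_; proj₁; proj₂)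

infixr 6 _∧'_
infixr 5 _∨'_
infixr 4 _⇒_ _□→_

data Form : Set where
  var  : ℕ → Form
  ⊥'   : Form
  _∧'_ : Form → Form → Form
  _∨'_ : Form → Form → Form
  _⇒_  : Form → Form → Form
  _□→_ : Form → Form → Form

⊤' : Form
⊤' = ⊥' ⇒ ⊥'

_⇔_ : Form → Form → Form
φ ⇔ ψ = (φ ⇒ ψ) ∧' (ψ ⇒ φ)

data ⊢H : Form → Set where
  ax-K    : ∀ φ ψ → ⊢H (φ ⇒ ψ ⇒ φ)
  ax-S    : ∀ φ ψ χ → ⊢H ((φ ⇒ ψ ⇒ χ) ⇒ (φ ⇒ ψ) ⇒ φ ⇒ χ)
  ax-∧E₁  : ∀ φ ψ → ⊢H (φ ∧' ψ ⇒ φ)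
  ax-∧E₂  : ∀ φ ψ → ⊢H (φ ∧' ψ ⇒ ψ)
  ax-∧I   : ∀ φ ψ → ⊢H (φ ⇒ ψ ⇒ φ ∧' ψ)
  ax-∨I₁  : ∀ φ ψ → ⊢H (φ ⇒ φ ∨' ψ)
  ax-∨I₂  : ∀ φ ψ → ⊢H (ψ ⇒ φ ∨' ψ)
  ax-∨E   : ∀ φ ψ χ → ⊢H ((φ ⇒ χ) ⇒ (ψ ⇒ χ) ⇒ φ ∨' ψ ⇒ χ)
  ax-⊥    : ∀ φ → ⊢H (⊥' ⇒ φ)
  mp      : ∀ {φ ψ} → ⊢H (φ ⇒ ψ) → ⊢H φ → ⊢H ψ
  ax-CM   : ∀ φ ψ χ → ⊢H ((φ □→ ψ ∧' χ) ⇒ (φ □→ ψ) ∧' (φ □→ χ))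
  ax-CC   : ∀ φ ψ χ → ⊢H ((φ □→ ψ) ∧' (φ □→ χ) ⇒ (φ □→ ψ ∧' χ))
  ax-CN   : ∀ φ → ⊢H (φ □→ ⊤')
  rule-RA : ∀ {φ ρ} ψ → ⊢H (φ ⇔ ρ) → ⊢H ((φ □→ ψ) ⇔ (ρ □→ ψ))
  rule-RC : ∀ {ψ χ} φ → ⊢H (ψ ⇔ χ) → ⊢H ((φ □→ ψ) ⇔ (φ □→ χ))

-- Sequent calculus S.ConstCK^□.
-- Antecedents are multisets, represented as lists up to permutation
-- (constructor `perm`); succedents have at most one formula (Maybe Form).

Ctx : Set
Ctx = List Form

data _⊢S_ : Ctx → Maybe Form → Set where
  perm  : ∀ {Γ Γ' Δ} → Γ ↭ Γ' → Γ ⊢S Δ → Γ' ⊢S Δ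
  init  : ∀ {Γ} p → (var p ∷ Γ) ⊢S just (var p)
  ⊥L    : ∀ {Γ Δ} → (⊥' ∷ Γ) ⊢S Δ
  ∧L    : ∀ {Γ Δ φ ψ} → (φ ∷ ψ ∷ Γ) ⊢S Δ → ((φ ∧' ψ) ∷ Γ) ⊢S Δ
  ∧R    : ∀ {Γ φ ψ} → Γ ⊢S just φ → Γ ⊢S just ψ → Γ ⊢S just (φ ∧' ψ)
  ∨L    : ∀ {Γ Δ φ ψ} → (φ ∷ Γ) ⊢S Δ → (ψ ∷ Γ) ⊢S Δ → ((φ ∨' ψ) ∷ Γ) ⊢S Δ
  ∨R₁   : ∀ {Γ φ ψ} → Γ ⊢S just φ → Γ ⊢S just (φ ∨' ψ)
  ∨R₂   : ∀ {Γ φ ψ} → Γ ⊢S just ψ → Γ ⊢S just (φ ∨' ψ)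
  ⇒R    : ∀ {Γ φ ψ} → (φ ∷ Γ) ⊢S just ψ → Γ ⊢S just (φ ⇒ ψ)
  ⇒L    : ∀ {Γ Δ φ ψ} → ((φ ⇒ ψ) ∷ Γ) ⊢S just φ → (ψ ∷ Γ) ⊢S Δ
        → ((φ ⇒ ψ) ∷ Γ) ⊢S Δ
  □R    : ∀ {Γ φ ψ} (rs : List (Form × Form))
        → All (λ r → (φ ∷ []) ⊢S just (proj₁ r)) rs
        → All (λ r → (proj₁ r ∷ []) ⊢S just φ) rs
        → map proj₂ rs ⊢S just ψ
        → (map (λ r → proj₁ r □→ proj₂ r) rs Data.List.++ Γ) ⊢S just (φ □→ ψ)

⋀ : List Form → Form
⋀ []           = ⊤'
⋀ (φ ∷ [])     = φ
⋀ (φ ∷ ψ ∷ Γ)  = φ ∧' ⋀ (ψ ∷ Γ)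

⋁ : Maybe Form → Form
⋁ nothing  = ⊥'
⋁ (just φ) = φ

ι : Ctx → Maybe Form → Form
ι []          Δ = ⋁ Δ
ι Γ@(_ ∷ _)   Δ = ⋀ Γ ⇒ ⋁ Δ

-- S.ConstCK□ consumes the principal formula of each left rule, so we work with a
-- variant _⊢_ in which it is kept. There weakening is immediate and cut is
-- admissible, by induction on the cut formula and then on the right derivation;
-- in the principal □-case the two □-rules merge, the premises of the left one
-- transported along the equivalence of the two antecedents. By the deduction
-- theorem _⊢_ is sound for ConstCK□: CC, CN and RA collect the boxes of a
-- □-rule, and RC with CM make □→ monotone in its consequent. Conversely, cut
-- simulates modus ponens. A _⊢_-derivation is replayed in S.ConstCK□ by tracking
-- the formulas that survive only through the remains of an earlier left rule.
module Submission where

open import Defs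
open import Data.Nat using (ℕ)
open import Data.List using (List; []; _∷_; [_]; _++_; map)
open import Data.List.Membership.Propositional using (_∈_)
open import Data.List.Membership.Propositional.Properties using (∈-++⁻; ∈-map⁺; ∈-map⁻; ∈-∃++)
open import Data.List.Relation.Binary.Subset.Propositional using (_⊆_)
open import Data.List.Relation.Binary.Subset.Propositional.Properties using (⊆-refl; ⊆-trans; ⊆-reflexive-↭; ∷⁺ʳ; ∈-∷⁺ʳ; xs⊆xs++ys; xs⊆ys++xs)
open import Data.List.Relation.Unary.Any using (here; there)
open import Data.List.Relation.Unary.All using (All; []; _∷_)
open import Data.List.Relation.Binary.Permutation.Propositional using (_↭_; refl; trans; ↭-sym)
open import Data.List.Relation.Binary.Permutation.Propositional.Properties using (∈-resp-↭; shift; ++⁺ˡ)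
open import Data.Maybe using (Maybe; just; nothing)
open import Data.Product using (∃; _×_; _,_; proj₁; proj₂)
open import Data.Sum using (inj₁; inj₂)
open import Relation.Binary.PropositionalEquality using (refl)

private variable
  p : ℕ
  Γ Γ' Γ'' Θ R : Ctx
  Δ : Maybe Form
  φ ψ χ ρ σ A : Form
  Σs Σs' : List Form

pattern #0 = here refl
pattern #1 = there #0
pattern #2 = there #1
pattern #3 = there #2

wk₂ : Γ ⊆ φ ∷ ψ ∷ Γ
wk₂ m = there (there m)

⊆-shift : ∀ Θ → φ ∷ Θ ++ Γ ⊆ Θ ++ φ ∷ Γ
⊆-shift Θ = ⊆-reflexive-↭ (↭-sym (shift _ Θ _))

⊆-under : Θ ⊆ A ∷ Γ → φ ∷ Θ ⊆ A ∷ φ ∷ Γ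
⊆-under s = ⊆-trans (∷⁺ʳ _ s) (⊆-shift [ _ ])

∈⇒↭∷ : φ ∈ Γ → ∃ λ R → Γ ↭ φ ∷ R
∈⇒↭∷ m with ∈-∃++ m
... | ys , zs , refl = ys ++ zs , shift _ ys zs

infix 2 _⊢ₕ_

data _⊢ₕ_ (Γ : Ctx) : Form → Set where
  hyp : φ ∈ Γ → Γ ⊢ₕ φ
  thm : ⊢H φ → Γ ⊢ₕ φ
  app : Γ ⊢ₕ φ ⇒ ψ → Γ ⊢ₕ φ → Γ ⊢ₕ ψ

⇒-refl : ∀ φ → ⊢H (φ ⇒ φ)
⇒-refl φ = mp (mp (ax-S φ (φ ⇒ φ) φ) (ax-K φ (φ ⇒ φ))) (ax-K φ φ)

deduction : φ ∷ Γ ⊢ₕ ψ → Γ ⊢ₕ φ ⇒ ψ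
deduction (hyp #0)        = thm (⇒-refl _)
deduction (hyp (there m)) = app (thm (ax-K _ _)) (hyp m)
deduction (thm t)         = app (thm (ax-K _ _)) (thm t)
deduction (app d e)       = app (app (thm (ax-S _ _ _)) (deduction d)) (deduction e)

⊢ₕ-closed : [] ⊢ₕ φ → ⊢H φ
⊢ₕ-closed (thm t)   = t
⊢ₕ-closed (app d e) = mp (⊢ₕ-closed d) (⊢ₕ-closed e)

⊢ₕ-subst : Θ ⊢ₕ φ → (∀ {χ} → χ ∈ Θ → Γ ⊢ₕ χ) → Γ ⊢ₕ φ
⊢ₕ-subst (hyp m)   f = f m
⊢ₕ-subst (thm t)   f = thm t
⊢ₕ-subst (app d e) f = app (⊢ₕ-subst d f) (⊢ₕ-subst e f)

∧-intro : Γ ⊢ₕ φ → Γ ⊢ₕ ψ → Γ ⊢ₕ φ ∧' ψ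
∧-intro d e = app (app (thm (ax-∧I _ _)) d) e

∧-elimˡ : Γ ⊢ₕ φ ∧' ψ → Γ ⊢ₕ φ
∧-elimˡ d = app (thm (ax-∧E₁ _ _)) d

∧-elimʳ : Γ ⊢ₕ φ ∧' ψ → Γ ⊢ₕ ψ
∧-elimʳ d = app (thm (ax-∧E₂ _ _)) d

⋀-elim : χ ∈ Θ → Γ ⊢ₕ ⋀ Θ → Γ ⊢ₕ χ
⋀-elim {Θ = _ ∷ []}    #0        d = d
⋀-elim {Θ = _ ∷ _ ∷ _} #0        d = ∧-elimˡ d
⋀-elim {Θ = _ ∷ _ ∷ _} (there m) d = ⋀-elim m (∧-elimʳ d)

-- RC replaces ψ by the equivalent ψ ∧ χ, and CM projects onto χ.
□→-monoʳ : ⊢H (ψ ⇒ χ) → ⊢H ((φ □→ ψ) ⇒ (φ □→ χ))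
□→-monoʳ {ψ} {χ} {φ} t =
  ⊢ₕ-closed (deduction (∧-elimʳ (app (thm (ax-CM φ ψ χ)) (app (∧-elimˡ (thm (rule-RC φ ψ⇔ψ∧χ))) (hyp #0)))))
  where
  ψ⇔ψ∧χ : ⊢H (ψ ⇔ (ψ ∧' χ))
  ψ⇔ψ∧χ = ⊢ₕ-closed (∧-intro (deduction (∧-intro (hyp #0) (app (thm t) (hyp #0)))) (thm (ax-∧E₁ ψ χ)))

infix 2 _⊢_

-- Left rules name their principal formula by membership and keep it in the
-- premises, so contexts behave like sets.
mutual
  data _⊢_ : Ctx → Maybe Form → Set where
    init : var p ∈ Γ → Γ ⊢ just (var p)
    ⊥L   : ⊥' ∈ Γ → Γ ⊢ Δ
    ∧L   : (φ ∧' ψ) ∈ Γ → φ ∷ ψ ∷ Γ ⊢ Δ → Γ ⊢ Δ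
    ∧R   : Γ ⊢ just φ → Γ ⊢ just ψ → Γ ⊢ just (φ ∧' ψ)
    ∨L   : (φ ∨' ψ) ∈ Γ → φ ∷ Γ ⊢ Δ → ψ ∷ Γ ⊢ Δ → Γ ⊢ Δ
    ∨R₁  : Γ ⊢ just φ → Γ ⊢ just (φ ∨' ψ)
    ∨R₂  : Γ ⊢ just ψ → Γ ⊢ just (φ ∨' ψ)
    ⇒R   : φ ∷ Γ ⊢ just ψ → Γ ⊢ just (φ ⇒ ψ)
    ⇒L   : (φ ⇒ ψ) ∈ Γ → Γ ⊢ just φ → ψ ∷ Γ ⊢ Δ → Γ ⊢ Δ
    □R   : □Premises Γ φ Σs → Σs ⊢ just ψ → Γ ⊢ just (φ □→ ψ)

  data □Premises (Γ : Ctx) (φ : Form) : List Form → Set where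
    []   : □Premises Γ φ []
    cons : (ρ □→ σ) ∈ Γ → [ φ ] ⊢ just ρ → [ ρ ] ⊢ just φ → □Premises Γ φ Σs → □Premises Γ φ (σ ∷ Σs)

□Premises-weaken : Γ ⊆ Γ' → □Premises Γ φ Σs → □Premises Γ' φ Σs
□Premises-weaken s []              = []
□Premises-weaken s (cons m f g bp) = cons (s m) f g (□Premises-weaken s bp)

□Premises-++ : □Premises Γ φ Σs → □Premises Γ φ Σs' → □Premises Γ φ (Σs ++ Σs')
□Premises-++ []              bp' = bp'
□Premises-++ (cons m f g bp) bp' = cons m f g (□Premises-++ bp bp')

⊢-weaken : Γ ⊆ Γ' → Γ ⊢ Δ → Γ' ⊢ Δ
⊢-weaken s (init m)     = init (s m)
⊢-weaken s (⊥L m)       = ⊥L (s m)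
⊢-weaken s (∧L m d)     = ∧L (s m) (⊢-weaken (∷⁺ʳ _ (∷⁺ʳ _ s)) d)
⊢-weaken s (∧R d e)     = ∧R (⊢-weaken s d) (⊢-weaken s e)
⊢-weaken s (∨L m d e)   = ∨L (s m) (⊢-weaken (∷⁺ʳ _ s) d) (⊢-weaken (∷⁺ʳ _ s) e)
⊢-weaken s (∨R₁ d)      = ∨R₁ (⊢-weaken s d)
⊢-weaken s (∨R₂ d)      = ∨R₂ (⊢-weaken s d)
⊢-weaken s (⇒R d)       = ⇒R (⊢-weaken (∷⁺ʳ _ s) d)
⊢-weaken s (⇒L m d e)   = ⇒L (s m) (⊢-weaken s d) (⊢-weaken (∷⁺ʳ _ s) e)
⊢-weaken s (□R bp d)    = □R (□Premises-weaken s bp) d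

⊢-hyp : ∀ φ → φ ∈ Γ → Γ ⊢ just φ
⊢-hyp (var p)  m = init m
⊢-hyp ⊥'       m = ⊥L m
⊢-hyp (φ ∧' ψ) m = ∧L m (∧R (⊢-hyp φ #0) (⊢-hyp ψ #1))
⊢-hyp (φ ∨' ψ) m = ∨L m (∨R₁ (⊢-hyp φ #0)) (∨R₂ (⊢-hyp ψ #0))
⊢-hyp (φ ⇒ ψ)  m = ⇒R (⇒L (there m) (⊢-hyp φ #0) (⊢-hyp ψ #0))
⊢-hyp (φ □→ ψ) m = □R (cons m (⊢-hyp φ #0) (⊢-hyp φ #0) []) (⊢-hyp ψ #0)

⊥R-elim : Γ ⊢ just ⊥' → Γ ⊢ Δ
⊥R-elim (⊥L m)     = ⊥L m
⊥R-elim (∧L m d)   = ∧L m (⊥R-elim d)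
⊥R-elim (∨L m d e) = ∨L m (⊥R-elim d) (⊥R-elim e)
⊥R-elim (⇒L m d e) = ⇒L m d (⊥R-elim e)

∧R-inv : Γ ⊢ just (φ ∧' ψ) → (Γ ⊢ just φ) × (Γ ⊢ just ψ)
∧R-inv (∧R d e)   = d , e
∧R-inv (⊥L m)     = ⊥L m , ⊥L m
∧R-inv (∧L m d)   = let (d₁ , d₂) = ∧R-inv d in ∧L m d₁ , ∧L m d₂
∧R-inv (∨L m d e) = let (d₁ , d₂) = ∧R-inv d ; (e₁ , e₂) = ∧R-inv e in ∨L m d₁ e₁ , ∨L m d₂ e₂
∧R-inv (⇒L m d e) = let (e₁ , e₂) = ∧R-inv e in ⇒L m d e₁ , ⇒L m d e₂

⇒R-inv : Γ ⊢ just (φ ⇒ ψ) → φ ∷ Γ ⊢ just ψ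
⇒R-inv (⇒R d)     = d
⇒R-inv (⊥L m)     = ⊥L (there m)
⇒R-inv (∧L m d)   = ∧L (there m) (⊢-weaken (⊆-shift (_ ∷ _ ∷ [])) (⇒R-inv d))
⇒R-inv (∨L m d e) = ∨L (there m) (⊢-weaken (⊆-shift [ _ ]) (⇒R-inv d)) (⊢-weaken (⊆-shift [ _ ]) (⇒R-inv e))
⇒R-inv (⇒L m d e) = ⇒L (there m) (⊢-weaken there d) (⊢-weaken (⊆-shift [ _ ]) (⇒R-inv e))

-- The premises of a □-rule over A ∷ Γ, those that are A (if any) merged into one.
data □Split (Γ : Ctx) (φ : Form) : Form → List Form → Set where
  unused : □Premises Γ φ Σs' → Σs ⊆ Σs' → □Split Γ φ A Σs
  used   : [ φ ] ⊢ just ρ → [ ρ ] ⊢ just φ → □Premises Γ φ Σs' → Σs ⊆ σ ∷ Σs' → □Split Γ φ (ρ □→ σ) Σs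

□split : □Premises Θ φ Σs → Θ ⊆ A ∷ Γ → □Split Γ φ A Σs
□split []              s = unused [] (λ ())
□split (cons m f g bp) s with s m | □split bp s
... | #0       | unused bp' sub       = used f g bp' (∷⁺ʳ _ sub)
... | #0       | used _ _ bp' sub     = used f g bp' (∈-∷⁺ʳ #0 sub)
... | there m' | unused bp' sub       = unused (cons m' f g bp') (∷⁺ʳ _ sub)
... | there m' | used f' g' bp' sub   = used f' g' (cons m' f g bp') (⊆-trans (∷⁺ʳ _ sub) (⊆-shift [ _ ]))

mutual
  cut : Γ ⊢ just A → Θ ⊢ Δ → Θ ⊆ A ∷ Γ → Γ ⊢ Δ
  cut d (init m) s with s m
  ... | #0       = d
  ... | there m' = init m'
  cut d (⊥L m) s with s m
  ... | #0       = ⊥R-elim d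
  ... | there m' = ⊥L m'
  cut d (∧L m e) s with s m | cut (⊢-weaken wk₂ d) e (⊆-under (⊆-under s))
  ... | #0       | e' = let (d₁ , d₂) = ∧R-inv d in cut d₁ (cut (⊢-weaken there d₂) e' (⊆-shift [ _ ])) ⊆-refl
  ... | there m' | e' = ∧L m' e'
  cut d (∧R e f) s = ∧R (cut d e s) (cut d f s)
  cut d (∨L m e f) s with s m | cut (⊢-weaken there d) e (⊆-under s) | cut (⊢-weaken there d) f (⊆-under s)
  ... | #0       | e' | f' = cut-∨ d e' f'
  ... | there m' | e' | f' = ∨L m' e' f'
  cut d (∨R₁ e) s = ∨R₁ (cut d e s)
  cut d (∨R₂ e) s = ∨R₂ (cut d e s)
  cut d (⇒R e) s = ⇒R (cut (⊢-weaken there d) e (⊆-under s))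
  cut d (⇒L m e f) s with s m | cut d e s | cut (⊢-weaken there d) f (⊆-under s)
  ... | #0       | e' | f' = cut (cut e' (⇒R-inv d) ⊆-refl) f' ⊆-refl
  ... | there m' | e' | f' = ⇒L m' e' f'
  cut d (□R bp e) s with □split bp s
  ... | unused bp' sub   = □R bp' (⊢-weaken sub e)
  ... | used f g bp' sub = cut-□ d f g bp' (⊢-weaken sub e)

  cut-∨ : Γ ⊢ just (φ ∨' ψ) → φ ∷ Γ ⊢ Δ → ψ ∷ Γ ⊢ Δ → Γ ⊢ Δ
  cut-∨ (∨R₁ d)    e f = cut d e ⊆-refl
  cut-∨ (∨R₂ d)    e f = cut d f ⊆-refl
  cut-∨ (⊥L m)     e f = ⊥L m
  cut-∨ (∧L m d)   e f = ∧L m (cut-∨ d (⊢-weaken (∷⁺ʳ _ wk₂) e) (⊢-weaken (∷⁺ʳ _ wk₂) f))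
  cut-∨ (∨L m d d') e f =
    ∨L m (cut-∨ d (⊢-weaken (∷⁺ʳ _ there) e) (⊢-weaken (∷⁺ʳ _ there) f))
         (cut-∨ d' (⊢-weaken (∷⁺ʳ _ there) e) (⊢-weaken (∷⁺ʳ _ there) f))
  cut-∨ (⇒L m d d') e f = ⇒L m d (cut-∨ d' (⊢-weaken (∷⁺ʳ _ there) e) (⊢-weaken (∷⁺ʳ _ there) f))

  cut-□ : Γ ⊢ just (ρ □→ σ) → [ φ ] ⊢ just ρ → [ ρ ] ⊢ just φ → □Premises Γ φ Σs → σ ∷ Σs ⊢ just ψ
        → Γ ⊢ just (φ □→ ψ)
  cut-□ {Σs = Σs} (□R {Σs = Σs'} bp d) f g bp₁ e =
    □R (□Premises-++ (□Premises-transport f g bp) bp₁)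
       (cut (⊢-weaken (xs⊆xs++ys Σs' Σs) d) e (∷⁺ʳ _ (xs⊆ys++xs Σs Σs')))
  cut-□ (⊥L m)      f g bp e = ⊥L m
  cut-□ (∧L m d)    f g bp e = ∧L m (cut-□ d f g (□Premises-weaken wk₂ bp) e)
  cut-□ (∨L m d d') f g bp e = ∨L m (cut-□ d f g (□Premises-weaken there bp) e) (cut-□ d' f g (□Premises-weaken there bp) e)
  cut-□ (⇒L m d d') f g bp e = ⇒L m d (cut-□ d' f g (□Premises-weaken there bp) e)

  □Premises-transport : [ φ ] ⊢ just ρ → [ ρ ] ⊢ just φ → □Premises Γ ρ Σs → □Premises Γ φ Σs
  □Premises-transport f g []              = []
  □Premises-transport f g (cons m a b bp) =
    cons m (cut f a (xs⊆xs++ys [ _ ] [ _ ])) (cut b g (xs⊆xs++ys [ _ ] [ _ ])) (□Premises-transport f g bp)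

mutual
  ⊢-sound : Γ ⊢ Δ → Γ ⊢ₕ ⋁ Δ
  ⊢-sound (init m)   = hyp m
  ⊢-sound (⊥L m)     = app (thm (ax-⊥ _)) (hyp m)
  ⊢-sound (∧L m d)   = app (app (deduction (deduction (⊢-sound d))) (∧-elimʳ (hyp m))) (∧-elimˡ (hyp m))
  ⊢-sound (∧R d e)   = ∧-intro (⊢-sound d) (⊢-sound e)
  ⊢-sound (∨L m d e) = app (app (app (thm (ax-∨E _ _ _)) (deduction (⊢-sound d))) (deduction (⊢-sound e))) (hyp m)
  ⊢-sound (∨R₁ d)    = app (thm (ax-∨I₁ _ _)) (⊢-sound d)
  ⊢-sound (∨R₂ d)    = app (thm (ax-∨I₂ _ _)) (⊢-sound d)
  ⊢-sound (⇒R d)     = deduction (⊢-sound d)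
  ⊢-sound (⇒L m d e) = app (deduction (⊢-sound e)) (app (hyp m) (⊢-sound d))
  ⊢-sound (□R bp d)  =
    app (thm (□→-monoʳ (⊢ₕ-closed (deduction (⊢ₕ-subst (⊢-sound d) (λ k → ⋀-elim k (hyp #0))))))) (□Premises-sound bp)

  □Premises-sound : □Premises Γ φ Σs → Γ ⊢ₕ φ □→ ⋀ Σs
  □Premises-sound []                            = thm (ax-CN _)
  □Premises-sound (cons m f g [])               = □premise-sound m f g
  □Premises-sound (cons m f g bp@(cons _ _ _ _)) = app (thm (ax-CC _ _ _)) (∧-intro (□premise-sound m f g) (□Premises-sound bp))

  □premise-sound : (ρ □→ σ) ∈ Γ → [ φ ] ⊢ just ρ → [ ρ ] ⊢ just φ → Γ ⊢ₕ φ □→ σ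
  □premise-sound {σ = σ} m f g =
    app (∧-elimʳ (thm (rule-RA σ (⊢ₕ-closed (∧-intro (deduction (⊢-sound f)) (deduction (⊢-sound g))))))) (hyp m)

⇔-inv : [] ⊢ just (φ ⇔ ρ) → ([ φ ] ⊢ just ρ) × ([ ρ ] ⊢ just φ)
⇔-inv d = let (d₁ , d₂) = ∧R-inv d in ⇒R-inv d₁ , ⇒R-inv d₂

⊢H-complete : ⊢H φ → [] ⊢ just φ
⊢H-complete (ax-K φ ψ)     = ⇒R (⇒R (⊢-hyp φ #1))
⊢H-complete (ax-S φ ψ χ)   = ⇒R (⇒R (⇒R (⇒L #1 (⊢-hyp φ #0) (⇒L #3 (⊢-hyp φ #1) (⇒L #0 (⊢-hyp ψ #1) (⊢-hyp χ #0))))))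
⊢H-complete (ax-∧E₁ φ ψ)   = ⇒R (∧L #0 (⊢-hyp φ #0))
⊢H-complete (ax-∧E₂ φ ψ)   = ⇒R (∧L #0 (⊢-hyp ψ #1))
⊢H-complete (ax-∧I φ ψ)    = ⇒R (⇒R (∧R (⊢-hyp φ #1) (⊢-hyp ψ #0)))
⊢H-complete (ax-∨I₁ φ ψ)   = ⇒R (∨R₁ (⊢-hyp φ #0))
⊢H-complete (ax-∨I₂ φ ψ)   = ⇒R (∨R₂ (⊢-hyp ψ #0))
⊢H-complete (ax-∨E φ ψ χ)  = ⇒R (⇒R (⇒R (∨L #0 (⇒L #3 (⊢-hyp φ #0) (⊢-hyp χ #0)) (⇒L #2 (⊢-hyp ψ #0) (⊢-hyp χ #0)))))
⊢H-complete (ax-⊥ φ)       = ⇒R (⊥L #0)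
⊢H-complete (mp t u)       = cut (⊢H-complete u) (⇒R-inv (⊢H-complete t)) ⊆-refl
⊢H-complete (ax-CM φ ψ χ)  =
  ⇒R (∧R (□R (cons #0 (⊢-hyp φ #0) (⊢-hyp φ #0) []) (∧L #0 (⊢-hyp ψ #0)))
         (□R (cons #0 (⊢-hyp φ #0) (⊢-hyp φ #0) []) (∧L #0 (⊢-hyp χ #1))))
⊢H-complete (ax-CC φ ψ χ)  =
  ⇒R (∧L #0 (□R (cons #0 (⊢-hyp φ #0) (⊢-hyp φ #0) (cons #1 (⊢-hyp φ #0) (⊢-hyp φ #0) []))
                (∧R (⊢-hyp ψ #0) (⊢-hyp χ #1))))
⊢H-complete (ax-CN φ)      = □R [] (⇒R (⊥L #0))
⊢H-complete (rule-RA ψ t)  =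
  let (f , g) = ⇔-inv (⊢H-complete t)
  in ∧R (⇒R (□R (cons #0 g f []) (⊢-hyp ψ #0))) (⇒R (□R (cons #0 f g []) (⊢-hyp ψ #0)))
⊢H-complete (rule-RC φ t)  =
  let (f , g) = ⇔-inv (⊢H-complete t)
  in ∧R (⇒R (□R (cons #0 (⊢-hyp φ #0) (⊢-hyp φ #0) []) f)) (⇒R (□R (cons #0 (⊢-hyp φ #0) (⊢-hyp φ #0) []) g))

box : Form × Form → Form
box (ρ , σ) = ρ □→ σ

mutual
  ⊢S⇒⊢ : Γ ⊢S Δ → Γ ⊢ Δ
  ⊢S⇒⊢ (perm p d)     = ⊢-weaken (∈-resp-↭ p) (⊢S⇒⊢ d)
  ⊢S⇒⊢ (init p)       = init #0
  ⊢S⇒⊢ ⊥L             = ⊥L #0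
  ⊢S⇒⊢ (∧L d)         = ∧L #0 (⊢-weaken (∷⁺ʳ _ (∷⁺ʳ _ there)) (⊢S⇒⊢ d))
  ⊢S⇒⊢ (∧R d e)       = ∧R (⊢S⇒⊢ d) (⊢S⇒⊢ e)
  ⊢S⇒⊢ (∨L d e)       = ∨L #0 (⊢-weaken (∷⁺ʳ _ there) (⊢S⇒⊢ d)) (⊢-weaken (∷⁺ʳ _ there) (⊢S⇒⊢ e))
  ⊢S⇒⊢ (∨R₁ d)        = ∨R₁ (⊢S⇒⊢ d)
  ⊢S⇒⊢ (∨R₂ d)        = ∨R₂ (⊢S⇒⊢ d)
  ⊢S⇒⊢ (⇒R d)         = ⇒R (⊢S⇒⊢ d)
  ⊢S⇒⊢ (⇒L d e)       = ⇒L #0 (⊢S⇒⊢ d) (⊢-weaken (∷⁺ʳ _ there) (⊢S⇒⊢ e))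
  ⊢S⇒⊢ (□R rs fs gs d) = □R (⊢S-□Premises rs fs gs) (⊢S⇒⊢ d)

  ⊢S-□Premises : (rs : List (Form × Form))
               → All (λ r → [ φ ] ⊢S just (proj₁ r)) rs → All (λ r → [ proj₁ r ] ⊢S just φ) rs
               → □Premises (map box rs ++ Γ) φ (map proj₂ rs)
  ⊢S-□Premises []       []       []       = []
  ⊢S-□Premises (r ∷ rs) (f ∷ fs) (g ∷ gs) =
    cons #0 (⊢S⇒⊢ f) (⊢S⇒⊢ g) (□Premises-weaken there (⊢S-□Premises rs fs gs))

-- A formula is covered by a context if it occurs in it, or if what its left rule
-- leaves behind does. S.ConstCK□ consumes principal formulas; a later use of the
-- same formula in a _⊢_-derivation is replayed with these remains.
data Covered (Γ : Ctx) : Form → Set where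
  present : φ ∈ Γ → Covered Γ φ
  ∧-parts : Covered Γ φ → Covered Γ ψ → Covered Γ (φ ∧' ψ)
  ∨-part₁ : Covered Γ φ → Covered Γ (φ ∨' ψ)
  ∨-part₂ : Covered Γ ψ → Covered Γ (φ ∨' ψ)
  ⇒-part  : Covered Γ ψ → Covered Γ (φ ⇒ ψ)

infix 4 _⊑_

_⊑_ : Ctx → Ctx → Set
Γ ⊑ Γ' = ∀ {φ} → φ ∈ Γ → Covered Γ' φ

Covered-⊑ : Covered Γ φ → Γ ⊑ Γ' → Covered Γ' φ
Covered-⊑ (present m)   c = c m
Covered-⊑ (∧-parts a b) c = ∧-parts (Covered-⊑ a c) (Covered-⊑ b c)
Covered-⊑ (∨-part₁ a)   c = ∨-part₁ (Covered-⊑ a c)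
Covered-⊑ (∨-part₂ b)   c = ∨-part₂ (Covered-⊑ b c)
Covered-⊑ (⇒-part b)    c = ⇒-part (Covered-⊑ b c)

⊑-trans : Γ ⊑ Γ' → Γ' ⊑ Γ'' → Γ ⊑ Γ''
⊑-trans c c' m = Covered-⊑ (c m) c'

⊆⇒⊑ : Γ ⊆ Γ' → Γ ⊑ Γ'
⊆⇒⊑ s m = present (s m)

⊑-∷ : Covered Γ' φ → Γ ⊑ Γ' → φ ∷ Γ ⊑ Γ'
⊑-∷ a c #0        = a
⊑-∷ a c (there m) = c m

⊑-decompose : Γ ⊑ Γ' → Γ' ↭ φ ∷ R → Covered Θ φ → R ⊆ Θ → Γ ⊑ Θ
⊑-decompose c p a s = ⊑-trans c (⊑-trans (⊆⇒⊑ (∈-resp-↭ p)) (⊑-∷ a (⊆⇒⊑ s)))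

focus : φ ∈ Γ → (∀ R → Γ ↭ φ ∷ R → (φ ∷ R) ⊢S Δ) → Γ ⊢S Δ
focus m k = let (R , p) = ∈⇒↭∷ m in perm (↭-sym p) (k R p)

box∈⇒consequent∈ : ∀ rs → (ρ □→ σ) ∈ map box rs → σ ∈ map proj₂ rs
box∈⇒consequent∈ rs m with ∈-map⁻ box m
... | _ , r∈rs , refl = ∈-map⁺ proj₂ r∈rs

record □Selection (Γ : Ctx) (φ : Form) (Σs : List Form) : Set where
  constructor selection
  field
    rs     : List (Form × Form)
    rest   : Ctx
    split  : Γ ↭ map box rs ++ rest
    fs     : All (λ r → [ φ ] ⊢S just (proj₁ r)) rs
    gs     : All (λ r → [ proj₁ r ] ⊢S just φ) rs
    covers : Σs ⊆ map proj₂ rs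

mutual
  ⊢⇒⊢S : Γ ⊢ Δ → Γ ⊑ Γ' → Γ' ⊢S Δ
  ⊢⇒⊢S (init m) c with c m
  ... | present m' = focus m' λ _ _ → init _
  ⊢⇒⊢S (⊥L m) c with c m
  ... | present m' = focus m' λ _ _ → ⊥L
  ⊢⇒⊢S (∧L m d) c with c m
  ... | present m'  = focus m' λ R p →
          ∧L (⊢⇒⊢S d (⊑-∷ (present #0) (⊑-∷ (present #1) (⊑-decompose c p (∧-parts (present #0) (present #1)) wk₂))))
  ... | ∧-parts a b = ⊢⇒⊢S d (⊑-∷ a (⊑-∷ b c))
  ⊢⇒⊢S (∧R d e) c = ∧R (⊢⇒⊢S d c) (⊢⇒⊢S e c)
  ⊢⇒⊢S (∨L m d e) c with c m
  ... | present m' = focus m' λ R p →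
          ∨L (⊢⇒⊢S d (⊑-∷ (present #0) (⊑-decompose c p (∨-part₁ (present #0)) there)))
             (⊢⇒⊢S e (⊑-∷ (present #0) (⊑-decompose c p (∨-part₂ (present #0)) there)))
  ... | ∨-part₁ a = ⊢⇒⊢S d (⊑-∷ a c)
  ... | ∨-part₂ b = ⊢⇒⊢S e (⊑-∷ b c)
  ⊢⇒⊢S (∨R₁ d) c = ∨R₁ (⊢⇒⊢S d c)
  ⊢⇒⊢S (∨R₂ d) c = ∨R₂ (⊢⇒⊢S d c)
  ⊢⇒⊢S (⇒R d) c = ⇒R (⊢⇒⊢S d (⊑-∷ (present #0) (⊑-trans c (⊆⇒⊑ there))))
  ⊢⇒⊢S (⇒L m d e) c with c m
  ... | present m' = focus m' λ R p →
          ⇒L (⊢⇒⊢S d (⊑-trans c (⊆⇒⊑ (∈-resp-↭ p))))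
             (⊢⇒⊢S e (⊑-∷ (present #0) (⊑-decompose c p (⇒-part (present #0)) there)))
  ... | ⇒-part b = ⊢⇒⊢S e (⊑-∷ b c)
  ⊢⇒⊢S (□R bp d) c with □select bp c
  ... | selection rs _ p fs gs covers = perm (↭-sym p) (□R rs fs gs (⊢⇒⊢S d (⊆⇒⊑ covers)))

  -- A box used twice by the _⊢_-rule is selected once.
  □select : □Premises Γ φ Σs → Γ ⊑ Γ' → □Selection Γ' φ Σs
  □select {Γ' = Γ'} [] c = selection [] Γ' refl [] [] (λ ())
  □select (cons m f g bp) c with c m | □select bp c
  ... | present m' | selection rs rest p fs gs covers with ∈-++⁻ (map box rs) (∈-resp-↭ p m')
  ...   | inj₁ k = selection rs rest p fs gs (∈-∷⁺ʳ (box∈⇒consequent∈ rs k) covers)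
  ...   | inj₂ k = let (R , q) = ∈⇒↭∷ k in
          selection (_ ∷ rs) R (trans p (trans (++⁺ˡ (map box rs) q) (shift _ (map box rs) R)))
                    (⊢⇒⊢S f present ∷ fs) (⊢⇒⊢S g present ∷ gs) (∷⁺ʳ _ covers)

⋀-right : Γ ⊆ Θ → Θ ⊢ just (⋀ Γ)
⋀-right {Γ = []}        s = ⇒R (⊥L #0)
⋀-right {Γ = _ ∷ []}    s = ⊢-hyp _ (s #0)
⋀-right {Γ = _ ∷ _ ∷ _} s = ∧R (⊢-hyp _ (s #0)) (⋀-right (λ m → s (there m)))

⋁-right : Γ ⊢ just (⋁ Δ) → Γ ⊢ Δ
⋁-right {Δ = just _}  d = d
⋁-right {Δ = nothing} d = ⊥R-elim d

ι-sound : Γ ⊢ Δ → ⊢H (ι Γ Δ)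
ι-sound {Γ = []}    d = ⊢ₕ-closed (⊢-sound d)
ι-sound {Γ = _ ∷ _} d = ⊢ₕ-closed (deduction (⊢ₕ-subst (⊢-sound d) (λ k → ⋀-elim k (hyp #0))))

ι-complete : ⊢H (ι Γ Δ) → Γ ⊢ Δ
ι-complete {Γ = []}    t = ⋁-right (⊢H-complete t)
ι-complete {Γ = _ ∷ _} t = ⋁-right (cut (⋀-right ⊆-refl) (⇒R-inv (⊢-weaken (λ ()) (⊢H-complete t))) ⊆-refl)

theorem7 : (Γ : Ctx) (Δ : Maybe Form) → (Γ ⊢S Δ → ⊢H (ι Γ Δ)) × (⊢H (ι Γ Δ) → Γ ⊢S Δ)
theorem7 Γ Δ = (λ d → ι-sound (⊢S⇒⊢ d)) , (λ t → ⊢⇒⊢S (ι-complete t) present)
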